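{- Let $p$ be a prime, $q=p^m$, let $\alpha\in\mathbb{F}_{q^3}$ generate a normal basis $\{\alpha,\alpha^q,\alpha^{q^2}\}$ of $\mathbb{F}_{q^3}$ over $\mathbb{F}_q$, and let $A,B,C\in\mathbb{F}_{q^3}$ with $A\neq0$ and $B\neq 0$. Let $\mathcal{S}_1$ be the surface defined below. Suppose $\mathcal{S}_1$ has exactly one singular point $P$ (over $\overline{\mathbb{F}}_q$). Then the number $h$ of $\mathbb{F}_q$-rational lines of $\mathbb{A}^3$ passing through $P$ and contained in $\mathcal{S}_1$ equals $0$.
   Context: Put $D=C+C^q+C^{q^2}\in\mathbb{F}_q$. For $j=0,1,2$ let $\xi_j=x_0\alpha^{q^j}+x_1\alpha^{q^{j+1}}+x_2\alpha^{q^{j+2}}$ (with $\alpha^{q^3}=\alpha$) and $F=-\xi_0\xi_1\xi_2+\sum_{j=0}^{2}(A^{q^j}\xi_j^2+B^{q^j}\xi_j)+D\in\mathbb{F}_q[x_0,x_1,x_2]$. $\mathcal{S}_1$ is the affine surface $F=0$ in $\mathbb{A}^3(\overline{\mathbb{F}}_q)$; a singular point is a point where $F$ and its three partial derivatives vanish. -}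

module Defs where

open import Level using (Level; _⊔_) renaming (suc to lsuc)
open import Algebra.Bundles using (CommutativeRing)
open import Data.Nat as ℕ using (ℕ; zero; suc)
open import Data.Nat.Primality using (Prime)
open import Data.List using (List; []; _∷_)
open import Data.Product using (_×_; _,_; ∃; Σ)
open import Relation.Nullary using (¬_)

module _ {c ℓ : Level} (R : CommutativeRing c ℓ) where
  open CommutativeRing R

  pow : Carrier → ℕ → Carrier
  pow x zero    = 1#
  pow x (suc n) = x * pow x n

  natR : ℕ → Carrier
  natR zero    = 0#
  natR (suc n) = 1# + natR n

  -- value at x of the monic polynomial  x^n + c_{n-1} x^{n-1} + … + c_0,
  -- where the list is [c_0, …, c_{n-1}] (Horner scheme)
  monicEval : List Carrier → Carrier → Carrier
  monicEval []       x = 1#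
  monicEval (a ∷ as) x = a + x * monicEval as x

-- An algebraically closed field (to play the role of \bar F_q).
record AlgClosedField (c ℓ : Level) : Set (lsuc (c ⊔ ℓ)) where
  field
    cring : CommutativeRing c ℓ
  open CommutativeRing cring public hiding (ring)
  field
    1≉0       : ¬ (1# ≈ 0#)
    inverse   : ∀ x → ¬ (x ≈ 0#) → ∃ λ y → x * y ≈ 1#
    algClosed : ∀ (a : Carrier) (as : List Carrier) → ∃ λ x → monicEval cring (a ∷ as) x ≈ 0#

module Surface {c ℓ : Level} (K : AlgClosedField c ℓ) (p m : ℕ) (α A B C : AlgClosedField.Carrier K) where
  open AlgClosedField K

  q : ℕ
  q = p ℕ.^ m

  _^_ : Carrier → ℕ → Carrier
  x ^ n = pow cring x n

  HasChar : Set ℓ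
  HasChar = natR cring p ≈ 0#

  InFq : Carrier → Set ℓ
  InFq x = x ^ q ≈ x

  InFq3 : Carrier → Set ℓ
  InFq3 x = x ^ (q ℕ.^ 3) ≈ x

  -- {α, α^q, α^{q^2}} is a basis of F_{q^3} over F_q (normal basis):
  -- α ∈ F_{q^3} and the three conjugates are F_q-linearly independent
  -- (three independent vectors in the 3-dimensional space F_{q^3}).
  NormalBasis : Set (c ⊔ ℓ)
  NormalBasis = InFq3 α ×
    (∀ a₀ a₁ a₂ → InFq a₀ → InFq a₁ → InFq a₂ →
       a₀ * α + a₁ * (α ^ q) + a₂ * (α ^ (q ℕ.^ 2)) ≈ 0# →
       (a₀ ≈ 0#) × (a₁ ≈ 0#) × (a₂ ≈ 0#))

  Point : Set c
  Point = Carrier × Carrier × Carrier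

  _≈₃_ : Point → Point → Set ℓ
  (x₀ , x₁ , x₂) ≈₃ (y₀ , y₁ , y₂) = (x₀ ≈ y₀) × (x₁ ≈ y₁) × (x₂ ≈ y₂)

  -- coefficient of x_i in ξ_j :  α^{q^{i+j}}  (using α^{q^3} = α)
  co : ℕ → ℕ → Carrier
  co j i = α ^ (q ℕ.^ (j ℕ.+ i))

  ξ : ℕ → Point → Carrier
  ξ j (x₀ , x₁ , x₂) = co j 0 * x₀ + co j 1 * x₁ + co j 2 * x₂

  Fr : ℕ → Carrier → Carrier
  Fr j y = y ^ (q ℕ.^ j)

  D : Carrier
  D = C + Fr 1 C + Fr 2 C

  two : Carrier
  two = 1# + 1#

  F : Point → Carrier
  F x = - (ξ 0 x * ξ 1 x * ξ 2 x)
        + ((Fr 0 A * (ξ 0 x * ξ 0 x) + Fr 0 B * ξ 0 x)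
        + (Fr 1 A * (ξ 1 x * ξ 1 x) + Fr 1 B * ξ 1 x)
        + (Fr 2 A * (ξ 2 x * ξ 2 x) + Fr 2 B * ξ 2 x))
        + D

  -- formal partial derivative ∂F/∂x_i (chain rule, ∂ξ_j/∂x_i = co j i)
  dF : ℕ → Point → Carrier
  dF i x = - (co 0 i * ξ 1 x * ξ 2 x + ξ 0 x * co 1 i * ξ 2 x + ξ 0 x * ξ 1 x * co 2 i)
           + ((two * Fr 0 A * ξ 0 x + Fr 0 B) * co 0 i
           + (two * Fr 1 A * ξ 1 x + Fr 1 B) * co 1 i
           + (two * Fr 2 A * ξ 2 x + Fr 2 B) * co 2 i)

  Singular : Point → Set ℓ
  Singular x = (F x ≈ 0#) × (dF 0 x ≈ 0#) × (dF 1 x ≈ 0#) × (dF 2 x ≈ 0#)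

  UniqueSingular : Point → Set (c ⊔ ℓ)
  UniqueSingular P = Singular P × (∀ Q → Singular Q → Q ≈₃ P)

  onLine : Point → Point → Carrier → Point
  onLine (a₀ , a₁ , a₂) (v₀ , v₁ , v₂) t = (a₀ + t * v₀ , a₁ + t * v₁ , a₂ + t * v₂)

  RationalLineThroughIn : Point → Set (c ⊔ ℓ)
  RationalLineThroughIn P =
    Σ Point λ { Q@(a₀ , a₁ , a₂) → Σ Point λ { v@(v₀ , v₁ , v₂) →
      InFq a₀ × InFq a₁ × InFq a₂ × InFq v₀ × InFq v₁ × InFq v₂ ×
      ¬ ((v₀ ≈ 0#) × (v₁ ≈ 0#) × (v₂ ≈ 0#)) ×
      (∃ λ t → P ≈₃ onLine Q v t) ×
      (∀ t → F (onLine Q v t) ≈ 0#) } }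

{-# OPTIONS --safe #-}

-- Over 𝔽_q the linear forms ξ₀, ξ₁, ξ₂ are conjugate, with the normal basis α, α^q, α^{q²} as
-- coefficients, so none of them vanishes at a nonzero 𝔽_q-rational vector v. Along a line Q + t v,
-- F is therefore a cubic in t with leading coefficient -ξ₀(v) ξ₁(v) ξ₂(v) ≠ 0, and such a polynomial
-- does not vanish identically over an algebraically closed field. Hence 𝒮₁ contains no 𝔽_q-rational
-- line at all, whether through P or not.

module Submission where

open import Level using (Level)
open import Algebra.Bundles using (CommutativeRing)
open import Data.Nat as ℕ using (ℕ; zero; suc; _≤_)
import Data.Nat.Properties as ℕₚ
open import Data.Nat.Primality using (Prime)
open import Data.Integer as ℤ using (ℤ; +_; -[1+_]; _⊖_)
import Data.Integer.Properties as ℤₚ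
open import Data.List using (List; []; _∷_; map)
open import Data.Maybe using (Maybe; just; nothing)
open import Data.Product using (_×_; _,_; ∃; ∃₂; map₂)
open import Relation.Nullary using (¬_; yes; no)
import Relation.Binary.PropositionalEquality as ≡
import Algebra.Solver.Ring.AlmostCommutativeRing as ACR
open import Defs

-- Algebra.Solver.Ring needs coefficients with a (weakly) decidable equality; ℤ, mapped into R by
-- its canonical homomorphism, provides them for an arbitrary commutative ring.
module CommutativeRingSolver {c ℓ : Level} (R : CommutativeRing c ℓ) where
  open CommutativeRing R
  open import Algebra.Properties.Ring ring using (-0#≈0#; -‿involutive; -‿+-comm; -‿distribˡ-*; -‿distribʳ-*)
  open import Algebra.Properties.Semiring.Mult semiring using (×-homo-+; ×1-homo-*) renaming (_×_ to _×ₙ_)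
  open import Algebra.Properties.CommutativeSemigroup +-commutativeSemigroup using (interchange)
  open import Relation.Binary.Reasoning.Setoid setoid

  fromℤ : ℤ → Carrier
  fromℤ (+ n)    = n ×ₙ 1#
  fromℤ -[1+ n ] = - (suc n ×ₙ 1#)

  fromℤ-⊖ : ∀ m n → fromℤ (m ⊖ n) ≈ m ×ₙ 1# + - (n ×ₙ 1#)
  fromℤ-⊖ m       zero    = trans (sym (+-identityʳ _)) (+-congˡ (sym -0#≈0#))
  fromℤ-⊖ zero    (suc n) = sym (+-identityˡ _)
  fromℤ-⊖ (suc m) (suc n) = begin
    fromℤ (suc m ⊖ suc n)                   ≡⟨ ≡.cong fromℤ (ℤₚ.[1+m]⊖[1+n]≡m⊖n m n) ⟩
    fromℤ (m ⊖ n)                           ≈⟨ fromℤ-⊖ m n ⟩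
    m ×ₙ 1# + - (n ×ₙ 1#)                     ≈⟨ +-identityˡ _ ⟨
    0# + (m ×ₙ 1# + - (n ×ₙ 1#))              ≈⟨ +-congʳ (-‿inverseʳ 1#) ⟨
    (1# + - 1#) + (m ×ₙ 1# + - (n ×ₙ 1#))     ≈⟨ interchange _ _ _ _ ⟩
    (1# + m ×ₙ 1#) + (- 1# + - (n ×ₙ 1#))     ≈⟨ +-congˡ (-‿+-comm _ _) ⟩
    (1# + m ×ₙ 1#) + - (1# + n ×ₙ 1#)         ∎

  fromℤ-+ : ∀ i j → fromℤ (i ℤ.+ j) ≈ fromℤ i + fromℤ j
  fromℤ-+ (+ m)    (+ n)    = ×-homo-+ 1# m n
  fromℤ-+ (+ m)    -[1+ n ] = fromℤ-⊖ m (suc n)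
  fromℤ-+ -[1+ m ] (+ n)    = trans (fromℤ-⊖ n (suc m)) (+-comm _ _)
  fromℤ-+ -[1+ m ] -[1+ n ] = begin
    - (suc (suc (m ℕ.+ n)) ×ₙ 1#)            ≡⟨ ≡.cong (λ k → - (suc k ×ₙ 1#)) (ℕₚ.+-suc m n) ⟨
    - ((suc m ℕ.+ suc n) ×ₙ 1#)              ≈⟨ -‿cong (×-homo-+ 1# (suc m) (suc n)) ⟩
    - (suc m ×ₙ 1# + suc n ×ₙ 1#)             ≈⟨ -‿+-comm _ _ ⟨
    - (suc m ×ₙ 1#) + - (suc n ×ₙ 1#)         ∎

  fromℤ-neg : ∀ i → fromℤ (ℤ.- i) ≈ - fromℤ i
  fromℤ-neg -[1+ n ]  = sym (-‿involutive _)
  fromℤ-neg (+ zero)  = sym -0#≈0#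
  fromℤ-neg (+ suc n) = refl

  fromℤ-*-pos : ∀ i n → fromℤ (i ℤ.* + n) ≈ fromℤ i * n ×ₙ 1#
  fromℤ-*-pos (+ m) n = begin
    fromℤ (+ m ℤ.* + n)                     ≡⟨ ≡.cong fromℤ (ℤₚ.pos-* m n) ⟨
    (m ℕ.* n) ×ₙ 1#                          ≈⟨ ×1-homo-* m n ⟩
    m ×ₙ 1# * n ×ₙ 1#                         ∎
  fromℤ-*-pos -[1+ m ] n = begin
    fromℤ (ℤ.- (+ suc m) ℤ.* + n)           ≡⟨ ≡.cong fromℤ (ℤₚ.neg-distribˡ-* (+ suc m) (+ n)) ⟨
    fromℤ (ℤ.- (+ suc m ℤ.* + n))           ≈⟨ fromℤ-neg (+ suc m ℤ.* + n) ⟩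
    - fromℤ (+ suc m ℤ.* + n)               ≈⟨ -‿cong (fromℤ-*-pos (+ suc m) n) ⟩
    - (suc m ×ₙ 1# * n ×ₙ 1#)                 ≈⟨ -‿distribˡ-* _ _ ⟩
    - (suc m ×ₙ 1#) * n ×ₙ 1#                 ∎

  fromℤ-* : ∀ i j → fromℤ (i ℤ.* j) ≈ fromℤ i * fromℤ j
  fromℤ-* i (+ n)    = fromℤ-*-pos i n
  fromℤ-* i -[1+ n ] = begin
    fromℤ (i ℤ.* ℤ.- (+ suc n))             ≡⟨ ≡.cong fromℤ (ℤₚ.neg-distribʳ-* i (+ suc n)) ⟨
    fromℤ (ℤ.- (i ℤ.* + suc n))             ≈⟨ fromℤ-neg (i ℤ.* + suc n) ⟩
    - fromℤ (i ℤ.* + suc n)                 ≈⟨ -‿cong (fromℤ-*-pos i (suc n)) ⟩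
    - (fromℤ i * suc n ×ₙ 1#)                ≈⟨ -‿distribʳ-* _ _ ⟩
    fromℤ i * - (suc n ×ₙ 1#)                ∎

  fromℤ-morphism : CommutativeRing.rawRing ℤₚ.+-*-commutativeRing ACR.-Raw-AlmostCommutative⟶ ACR.fromCommutativeRing R
  fromℤ-morphism = record
    { ⟦_⟧    = fromℤ
    ; +-homo = fromℤ-+
    ; *-homo = fromℤ-*
    ; -‿homo = fromℤ-neg
    ; 0-homo = refl
    ; 1-homo = +-identityʳ 1#
    }

  fromℤ-≟ : ∀ i j → Maybe (fromℤ i ≈ fromℤ j)
  fromℤ-≟ i j with i ℤ.≟ j
  ... | yes ≡.refl = just refl
  ... | no _       = nothing

  open import Algebra.Solver.Ring (CommutativeRing.rawRing ℤₚ.+-*-commutativeRing) (ACR.fromCommutativeRing R) fromℤ-morphism fromℤ-≟ public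
    using (Polynomial; solve; _:=_; _:+_; _:*_; :-_)

module Horner {c ℓ : Level} (R : CommutativeRing c ℓ) where
  open CommutativeRing R
  open import Algebra.Properties.CommutativeSemigroup *-commutativeSemigroup using (x∙yz≈y∙xz)
  open import Relation.Binary.Reasoning.Setoid setoid

  -- horner (c₀ ∷ … ∷ cₙ₋₁) cₙ x = c₀ + c₁ x + … + cₙ xⁿ
  horner : List Carrier → Carrier → Carrier → Carrier
  horner []       cₙ x = cₙ
  horner (a ∷ as) cₙ x = a + x * horner as cₙ x

  horner-cong-leading : ∀ as {cₙ dₙ} x → cₙ ≈ dₙ → horner as cₙ x ≈ horner as dₙ x
  horner-cong-leading []       x cₙ≈dₙ = cₙ≈dₙ
  horner-cong-leading (a ∷ as) x cₙ≈dₙ = +-congˡ (*-congˡ (horner-cong-leading as x cₙ≈dₙ))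

  monicEval≈horner : ∀ as x → monicEval R as x ≈ horner as 1# x
  monicEval≈horner []       x = refl
  monicEval≈horner (a ∷ as) x = +-congˡ (*-congˡ (monicEval≈horner as x))

  *-horner : ∀ y as cₙ x → y * horner as cₙ x ≈ horner (map (y *_) as) (y * cₙ) x
  *-horner y []       cₙ x = refl
  *-horner y (a ∷ as) cₙ x = begin
    y * (a + x * horner as cₙ x)              ≈⟨ distribˡ y a _ ⟩
    y * a + y * (x * horner as cₙ x)          ≈⟨ +-congˡ (x∙yz≈y∙xz y x _) ⟩
    y * a + x * (y * horner as cₙ x)          ≈⟨ +-congˡ (*-congˡ (*-horner y as cₙ x)) ⟩
    y * a + x * horner (map (y *_) as) (y * cₙ) x ∎

module AlgClosedFieldProperties {c ℓ : Level} (K : AlgClosedField c ℓ) where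
  open AlgClosedField K
  open Horner cring
  open import Algebra.Properties.Ring (CommutativeRing.ring cring) using (-0#≈0#; -‿involutive)
  open import Algebra.Properties.CommutativeSemigroup +-commutativeSemigroup using (xy∙z≈xz∙y)
  open import Relation.Binary.Reasoning.Setoid setoid

  *-≉0 : ∀ {x y} → ¬ x ≈ 0# → ¬ y ≈ 0# → ¬ x * y ≈ 0#
  *-≉0 {x} {y} x≉0 y≉0 xy≈0 with inverse x x≉0
  ... | x⁻¹ , xx⁻¹≈1 = y≉0 (begin
    y                  ≈⟨ *-identityˡ y ⟨
    1# * y             ≈⟨ *-congʳ xx⁻¹≈1 ⟨
    x * x⁻¹ * y        ≈⟨ *-congʳ (*-comm x x⁻¹) ⟩
    x⁻¹ * x * y        ≈⟨ *-assoc x⁻¹ x y ⟩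
    x⁻¹ * (x * y)      ≈⟨ *-congˡ xy≈0 ⟩
    x⁻¹ * 0#           ≈⟨ zeroʳ x⁻¹ ⟩
    0#                 ∎)

  -‿≉0 : ∀ {x} → ¬ x ≈ 0# → ¬ - x ≈ 0#
  -‿≉0 x≉0 -x≈0 = x≉0 (trans (sym (-‿involutive _)) (trans (-‿cong -x≈0) -0#≈0#))

  -- Dividing by the leading coefficient and adding 1 gives a monic polynomial,
  -- and at any of its roots the original polynomial takes the value -cₙ.
  horner-≉0-somewhere : ∀ a as cₙ → ¬ cₙ ≈ 0# → ∃ λ x → ¬ horner (a ∷ as) cₙ x ≈ 0#
  horner-≉0-somewhere a as cₙ cₙ≉0 with inverse cₙ cₙ≉0
  ... | y , cₙy≈1 with algClosed (y * a + 1#) (map (y *_) as)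
  ... | x , root = x , λ p[x]≈0 → 1≉0 (begin
      1#                   ≈⟨ +-identityˡ 1# ⟨
      0# + 1#              ≈⟨ +-congʳ (scaled≈0 p[x]≈0) ⟨
      y * a + x * H + 1#   ≈⟨ xy∙z≈xz∙y _ _ _ ⟩
      y * a + 1# + x * H   ≈⟨ monicEval≈horner (y * a + 1# ∷ map (y *_) as) x ⟨
      monicEval cring (y * a + 1# ∷ map (y *_) as) x ≈⟨ root ⟩
      0#                   ∎)
    where
    H : Carrier
    H = horner (map (y *_) as) 1# x

    scaled≈0 : horner (a ∷ as) cₙ x ≈ 0# → y * a + x * H ≈ 0#
    scaled≈0 p[x]≈0 = begin
      y * a + x * H                                  ≈⟨ +-congˡ (*-congˡ (horner-cong-leading (map (y *_) as) x yc≈1)) ⟨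
      horner (map (y *_) (a ∷ as)) (y * cₙ) x        ≈⟨ *-horner y (a ∷ as) cₙ x ⟨
      y * horner (a ∷ as) cₙ x                       ≈⟨ *-congˡ p[x]≈0 ⟩
      y * 0#                                         ≈⟨ zeroʳ y ⟩
      0#                                             ∎
      where
      yc≈1 : y * cₙ ≈ 1#
      yc≈1 = trans (*-comm y cₙ) cₙy≈1

module PowerProperties {c ℓ : Level} (R : CommutativeRing c ℓ) where
  open CommutativeRing R
  open import Algebra.Properties.Semiring.Exp semiring as Exp using (^-assocʳ; ^-congˡ)
  open import Relation.Binary.Reasoning.Setoid setoid

  pow≈^ : ∀ x n → pow R x n ≈ x Exp.^ n
  pow≈^ x zero    = refl
  pow≈^ x (suc n) = *-congˡ (pow≈^ x n)

  pow-congˡ : ∀ {x y} n → x ≈ y → pow R x n ≈ pow R y n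
  pow-congˡ {x} {y} n x≈y = trans (pow≈^ x n) (trans (^-congˡ n x≈y) (sym (pow≈^ y n)))

  pow-* : ∀ x k n → pow R x (k ℕ.* n) ≈ pow R (pow R x n) k
  pow-* x k n = begin
    pow R x (k ℕ.* n)          ≈⟨ pow≈^ x (k ℕ.* n) ⟩
    x Exp.^ (k ℕ.* n)          ≡⟨ ≡.cong (x Exp.^_) (ℕₚ.*-comm k n) ⟩
    x Exp.^ (n ℕ.* k)          ≈⟨ ^-assocʳ x n k ⟨
    (x Exp.^ n) Exp.^ k        ≈⟨ ^-congˡ k (pow≈^ x n) ⟨
    pow R x n Exp.^ k          ≈⟨ pow≈^ (pow R x n) k ⟨
    pow R (pow R x n) k        ∎

module TernaryForms {c ℓ : Level} (R : CommutativeRing c ℓ) where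
  open CommutativeRing R
  open CommutativeRingSolver R
  open Horner R

  linear-along-line : ∀ c₀ c₁ c₂ a₀ a₁ a₂ v₀ v₁ v₂ t →
    c₀ * (a₀ + t * v₀) + c₁ * (a₁ + t * v₁) + c₂ * (a₂ + t * v₂) ≈
    (c₀ * a₀ + c₁ * a₁ + c₂ * a₂) + t * (c₀ * v₀ + c₁ * v₁ + c₂ * v₂)
  linear-along-line = solve 10 (λ c₀ c₁ c₂ a₀ a₁ a₂ v₀ v₁ v₂ t →
    c₀ :* (a₀ :+ t :* v₀) :+ c₁ :* (a₁ :+ t :* v₁) :+ c₂ :* (a₂ :+ t :* v₂) :=
    (c₀ :* a₀ :+ c₁ :* a₁ :+ c₂ :* a₂) :+ t :* (c₀ :* v₀ :+ c₁ :* v₁ :+ c₂ :* v₂)) refl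

  linear-form-cong : ∀ {c₀ c₁ c₂ d₀ d₁ d₂} x₀ x₁ x₂ → c₀ ≈ d₀ → c₁ ≈ d₁ → c₂ ≈ d₂ →
    c₀ * x₀ + c₁ * x₁ + c₂ * x₂ ≈ x₀ * d₀ + x₁ * d₁ + x₂ * d₂
  linear-form-cong x₀ x₁ x₂ e₀ e₁ e₂ =
    +-cong (+-cong (trans (*-congʳ e₀) (*-comm _ x₀)) (trans (*-congʳ e₁) (*-comm _ x₁))) (trans (*-congʳ e₂) (*-comm _ x₂))

  cubicForm : (a₀ a₁ a₂ b₀ b₁ b₂ d x₀ x₁ x₂ : Carrier) → Carrier
  cubicForm a₀ a₁ a₂ b₀ b₁ b₂ d x₀ x₁ x₂ =
    - (x₀ * x₁ * x₂)
    + ((a₀ * (x₀ * x₀) + b₀ * x₀) + (a₁ * (x₁ * x₁) + b₁ * x₁) + (a₂ * (x₂ * x₂) + b₂ * x₂))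
    + d

  cubicForm-cong : ∀ a₀ a₁ a₂ b₀ b₁ b₂ d {x₀ x₁ x₂ y₀ y₁ y₂} → x₀ ≈ y₀ → x₁ ≈ y₁ → x₂ ≈ y₂ →
    cubicForm a₀ a₁ a₂ b₀ b₁ b₂ d x₀ x₁ x₂ ≈ cubicForm a₀ a₁ a₂ b₀ b₁ b₂ d y₀ y₁ y₂
  cubicForm-cong _ _ _ _ _ _ _ e₀ e₁ e₂ = +-congʳ (+-cong (-‿cong (*-cong (*-cong e₀ e₁) e₂))
    (+-cong (+-cong (quadratic e₀) (quadratic e₁)) (quadratic e₂)))
    where
    quadratic : ∀ {a b x y} → x ≈ y → a * (x * x) + b * x ≈ a * (y * y) + b * y
    quadratic e = +-cong (*-congˡ (*-cong e e)) (*-congˡ e)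

  cubicForm-along-line : ∀ a₀ a₁ a₂ b₀ b₁ b₂ d x₀ x₁ x₂ w₀ w₁ w₂ → ∃₂ λ k₁ k₂ → ∀ t →
    cubicForm a₀ a₁ a₂ b₀ b₁ b₂ d (x₀ + t * w₀) (x₁ + t * w₁) (x₂ + t * w₂) ≈
    horner (cubicForm a₀ a₁ a₂ b₀ b₁ b₂ d x₀ x₁ x₂ ∷ k₁ ∷ k₂ ∷ []) (- (w₀ * w₁ * w₂)) t
  cubicForm-along-line a₀ a₁ a₂ b₀ b₁ b₂ d x₀ x₁ x₂ w₀ w₁ w₂ =
    _ , _ , solve 14 (λ a₀ a₁ a₂ b₀ b₁ b₂ d x₀ x₁ x₂ w₀ w₁ w₂ t →
      let Φ : Polynomial 14 → Polynomial 14 → Polynomial 14 → Polynomial 14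
          Φ y₀ y₁ y₂ = :- (y₀ :* y₁ :* y₂)
            :+ ((a₀ :* (y₀ :* y₀) :+ b₀ :* y₀) :+ (a₁ :* (y₁ :* y₁) :+ b₁ :* y₁) :+ (a₂ :* (y₂ :* y₂) :+ b₂ :* y₂))
            :+ d
      in Φ (x₀ :+ t :* w₀) (x₁ :+ t :* w₁) (x₂ :+ t :* w₂) :=
         Φ x₀ x₁ x₂
         :+ t :* ((:- (x₀ :* x₁ :* w₂ :+ x₀ :* w₁ :* x₂ :+ w₀ :* x₁ :* x₂)
                   :+ ((a₀ :* x₀ :* w₀ :+ a₀ :* x₀ :* w₀ :+ b₀ :* w₀)
                      :+ (a₁ :* x₁ :* w₁ :+ a₁ :* x₁ :* w₁ :+ b₁ :* w₁)
                      :+ (a₂ :* x₂ :* w₂ :+ a₂ :* x₂ :* w₂ :+ b₂ :* w₂)))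
         :+ t :* ((:- (x₀ :* w₁ :* w₂ :+ w₀ :* x₁ :* w₂ :+ w₀ :* w₁ :* x₂)
                   :+ (a₀ :* (w₀ :* w₀) :+ a₁ :* (w₁ :* w₁) :+ a₂ :* (w₂ :* w₂)))
         :+ t :* :- (w₀ :* w₁ :* w₂))))
      refl a₀ a₁ a₂ b₀ b₁ b₂ d x₀ x₁ x₂ w₀ w₁ w₂

module _ {c ℓ : Level} (K : AlgClosedField c ℓ) (p m : ℕ) (α A B C : AlgClosedField.Carrier K) where
  open AlgClosedField K
  open Surface K p m α A B C
  open AlgClosedFieldProperties K
  open Horner cring
  open TernaryForms cring
  open PowerProperties cring
  open import Algebra.Properties.CommutativeSemigroup +-commutativeSemigroup using (xy∙z≈z∙xy; xy∙z≈yz∙x)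

  ξ-norm : Point → Carrier
  ξ-norm V = ξ 0 V * ξ 1 V * ξ 2 V

  ξ-onLine : ∀ j Q V t → ξ j (onLine Q V t) ≈ ξ j Q + t * ξ j V
  ξ-onLine j (a₀ , a₁ , a₂) (v₀ , v₁ , v₂) = linear-along-line (co j 0) (co j 1) (co j 2) a₀ a₁ a₂ v₀ v₁ v₂

  F-onLine : ∀ Q V → ∃₂ λ k₁ k₂ → ∀ t → F (onLine Q V t) ≈ horner (F Q ∷ k₁ ∷ k₂ ∷ []) (- ξ-norm V) t
  F-onLine Q V = map₂ (map₂ (λ expand t → trans (F-onLine≈cubicForm t) (expand t)))
    (cubicForm-along-line (Fr 0 A) (Fr 1 A) (Fr 2 A) (Fr 0 B) (Fr 1 B) (Fr 2 B) D
                          (ξ 0 Q) (ξ 1 Q) (ξ 2 Q) (ξ 0 V) (ξ 1 V) (ξ 2 V))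
    where
    F-onLine≈cubicForm : ∀ t → F (onLine Q V t) ≈
      cubicForm (Fr 0 A) (Fr 1 A) (Fr 2 A) (Fr 0 B) (Fr 1 B) (Fr 2 B) D
                (ξ 0 Q + t * ξ 0 V) (ξ 1 Q + t * ξ 1 V) (ξ 2 Q + t * ξ 2 V)
    F-onLine≈cubicForm t = cubicForm-cong (Fr 0 A) (Fr 1 A) (Fr 2 A) (Fr 0 B) (Fr 1 B) (Fr 2 B) D
      (ξ-onLine 0 Q V t) (ξ-onLine 1 Q V t) (ξ-onLine 2 Q V t)

  line⊈S₁ : ∀ Q V → ¬ ξ-norm V ≈ 0# → ¬ (∀ t → F (onLine Q V t) ≈ 0#)
  line⊈S₁ Q V N≉0 F≈0 =
    let k₁ , k₂ , expand = F-onLine Q V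
        t , value≉0     = horner-≉0-somewhere (F Q) (k₁ ∷ k₂ ∷ []) (- ξ-norm V) (-‿≉0 N≉0)
    in value≉0 (trans (sym (expand t)) (F≈0 t))

  normalCombination : Carrier → Carrier → Carrier → Carrier
  normalCombination a₀ a₁ a₂ = a₀ * α + a₁ * (α ^ q) + a₂ * (α ^ (q ℕ.^ 2))

  module _ (α∈Fq³ : InFq3 α) where
    α^q⁰≈α : α ^ (q ℕ.^ 0) ≈ α
    α^q⁰≈α = *-identityʳ α

    α^q¹≈α^q : α ^ (q ℕ.^ 1) ≈ α ^ q
    α^q¹≈α^q = reflexive (≡.cong (α ^_) (ℕₚ.*-identityʳ q))

    α^q⁴≈α^q : α ^ (q ℕ.^ 4) ≈ α ^ q
    α^q⁴≈α^q = trans (pow-* α q (q ℕ.^ 3)) (pow-congˡ q α∈Fq³)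

    ξ₀≈normalCombination : ∀ v₀ v₁ v₂ → ξ 0 (v₀ , v₁ , v₂) ≈ normalCombination v₀ v₁ v₂
    ξ₀≈normalCombination v₀ v₁ v₂ = linear-form-cong v₀ v₁ v₂ α^q⁰≈α α^q¹≈α^q refl

    ξ₁≈normalCombination : ∀ v₀ v₁ v₂ → ξ 1 (v₀ , v₁ , v₂) ≈ normalCombination v₂ v₀ v₁
    ξ₁≈normalCombination v₀ v₁ v₂ =
      trans (linear-form-cong v₀ v₁ v₂ α^q¹≈α^q refl α∈Fq³) (trans (xy∙z≈z∙xy _ _ _) (sym (+-assoc _ _ _)))

    ξ₂≈normalCombination : ∀ v₀ v₁ v₂ → ξ 2 (v₀ , v₁ , v₂) ≈ normalCombination v₁ v₂ v₀
    ξ₂≈normalCombination v₀ v₁ v₂ = trans (linear-form-cong v₀ v₁ v₂ refl α∈Fq³ α^q⁴≈α^q) (xy∙z≈yz∙x _ _ _)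

  rational-ξ-norm≉0 : NormalBasis → ∀ v₀ v₁ v₂ → InFq v₀ → InFq v₁ → InFq v₂ →
    ¬ ((v₀ ≈ 0#) × (v₁ ≈ 0#) × (v₂ ≈ 0#)) → ¬ ξ-norm (v₀ , v₁ , v₂) ≈ 0#
  rational-ξ-norm≉0 (α∈Fq³ , independent) v₀ v₁ v₂ r₀ r₁ r₂ v≉0 = *-≉0 (*-≉0 ξ₀≉0 ξ₁≉0) ξ₂≉0
    where
    ξ₀≉0 : ¬ ξ 0 (v₀ , v₁ , v₂) ≈ 0#
    ξ₀≉0 ξ₀≈0 = v≉0 (independent v₀ v₁ v₂ r₀ r₁ r₂ (trans (sym (ξ₀≈normalCombination α∈Fq³ v₀ v₁ v₂)) ξ₀≈0))

    ξ₁≉0 : ¬ ξ 1 (v₀ , v₁ , v₂) ≈ 0#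
    ξ₁≉0 ξ₁≈0 with independent v₂ v₀ v₁ r₂ r₀ r₁ (trans (sym (ξ₁≈normalCombination α∈Fq³ v₀ v₁ v₂)) ξ₁≈0)
    ... | v₂≈0 , v₀≈0 , v₁≈0 = v≉0 (v₀≈0 , v₁≈0 , v₂≈0)

    ξ₂≉0 : ¬ ξ 2 (v₀ , v₁ , v₂) ≈ 0#
    ξ₂≉0 ξ₂≈0 with independent v₁ v₂ v₀ r₁ r₂ r₀ (trans (sym (ξ₂≈normalCombination α∈Fq³ v₀ v₁ v₂)) ξ₂≈0)
    ... | v₁≈0 , v₂≈0 , v₀≈0 = v≉0 (v₀≈0 , v₁≈0 , v₂≈0)

mainTheorem3 : ∀ {c ℓ : Level} (K : AlgClosedField c ℓ) (p m : ℕ) (α A B C : AlgClosedField.Carrier K) →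
    Prime p → 1 ≤ m → Surface.HasChar K p m α A B C →
    Surface.NormalBasis K p m α A B C →
    Surface.InFq3 K p m α A B C A → Surface.InFq3 K p m α A B C B → Surface.InFq3 K p m α A B C C →
    ¬ (AlgClosedField._≈_ K A (AlgClosedField.0# K)) → ¬ (AlgClosedField._≈_ K B (AlgClosedField.0# K)) →
    (P : Surface.Point K p m α A B C) → Surface.UniqueSingular K p m α A B C P →
    ¬ Surface.RationalLineThroughIn K p m α A B C P
mainTheorem3 K p m α A B C _ _ _ nb _ _ _ _ _ _ _ (Q , (v₀ , v₁ , v₂) , _ , _ , _ , r₀ , r₁ , r₂ , v≉0 , _ , line⊆S₁) =
  line⊈S₁ K p m α A B C Q (v₀ , v₁ , v₂) (rational-ξ-norm≉0 K p m α A B C nb v₀ v₁ v₂ r₀ r₁ r₂ v≉0) line⊆S₁
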